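{- Let $P_T(x,y,z) = x^3+2x^2y+x^2z+2xy^2-2xyz-xz^2+2y^3-2yz^2+z^3$, and let $(T_n)_{n\ge 0}$ be the Tribonacci numbers defined by $T_0 = T_1 = 0$, $T_2 = 1$, and $T_n = T_{n-1}+T_{n-2}+T_{n-3}$ for $n \ge 3$. If $x,y,z$ are integers with $0 < x < y < z$ and $P_T(x,y,z) = 1$, then $(x,y,z) = (T_n, T_{n+1}, T_{n+2})$ for some integer $n \ge 0$. -}

module Defs where

open import Data.Nat using (ℕ; zero; suc)
open import Data.Integer using (ℤ; +_; _+_; _-_; _*_)

T : ℕ → ℤ
T zero = + 0
T (suc zero) = + 0
T (suc (suc zero)) = + 1
T (suc (suc (suc n))) = T (suc (suc n)) + T (suc n) + T n

P-T : ℤ → ℤ → ℤ → ℤ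
P-T x y z =
  x * x * x + + 2 * x * x * y + x * x * z + + 2 * x * y * y
  - + 2 * x * y * z - x * z * z + + 2 * y * y * y - + 2 * y * z * z
  + z * z * z

-- The step (w, x, y) ↦ (x, y, y + x + w) of the Tribonacci recurrence preserves P_T, so a
-- solution 0 < x < y < z descends to the solution (z − y − x, x, y). Positivity certificates,
-- which write P_T − 2 as a polynomial with nonnegative coefficients in slack variables, show
-- that z ≤ y + x is impossible and that z − y − x ≥ x forces (x, y, z) = (1, 2, 4), which is
-- (T 3, T 4, T 5). Otherwise 0 < z − y − x < x, and well-founded induction on x concludes.
module Submission where

open import Defs
open import Data.Nat using (ℕ; suc)
open import Data.Product using (∃; _×_; _,_)
open import Data.Sum using (_⊎_; inj₁; inj₂)
import Data.Sum as Sum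
open import Data.Empty using (⊥-elim)
open import Data.Integer using (ℤ; +_)
import Data.Integer as ℤ
open import Induction.WellFounded using (Acc; acc)
open import Relation.Nullary using (¬_)
open import Relation.Binary.PropositionalEquality
  using (_≡_; _≢_; refl; sym; trans; cong; cong₂; module ≡-Reasoning)

-- ℕ's order and arithmetic are opened only inside this block: the statement of proposition3p3
-- uses ℤ's _<_.
module _ where
  open import Data.Nat using (zero; _+_; _*_; _≤_; _<_; z<s)
  open import Data.Nat.Properties
    using (m≤n⇒∃[o]m+o≡n; ≤-total; ≤-<-connex; ≤-reflexive; +-identityʳ; +-comm;
           +-cancelˡ-<; +-cancelˡ-≡; +-cancelʳ-≡)
  open import Data.Nat.Tactic.RingSolver using (solve-∀)

  ≤-total-∃ : ∀ m n → (∃ λ k → m + k ≡ n) ⊎ (∃ λ k → n + k ≡ m)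
  ≤-total-∃ m n =
    Sum.map (λ m≤n → m≤n⇒∃[o]m+o≡n m≤n) (λ n≤m → m≤n⇒∃[o]m+o≡n n≤m) (≤-total m n)

  ≤-<-connex-∃ : ∀ m n → (∃ λ k → m + k ≡ n) ⊎ (∃ λ k → suc n + k ≡ m)
  ≤-<-connex-∃ m n =
    Sum.map (λ m≤n → m≤n⇒∃[o]m+o≡n m≤n) (λ n<m → m≤n⇒∃[o]m+o≡n n<m) (≤-<-connex m n)

  -- P_T = P⁺ − P⁻ separates the negative monomials, so that on naturals P_T x y z = 1 can be
  -- stated without truncated subtraction. Inlined so that the ring solver sees through them.
  P⁺ P⁻ : ℕ → ℕ → ℕ → ℕ
  P⁺ x y z = x * x * x + 2 * x * x * y + x * x * z + 2 * x * y * y + 2 * y * y * y + z * z * z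
  P⁻ x y z = 2 * x * y * z + x * z * z + 2 * y * z * z
  {-# INLINE P⁺ #-}
  {-# INLINE P⁻ #-}

  Solution : ℕ → ℕ → ℕ → Set
  Solution x y z = P⁺ x y z ≡ 1 + P⁻ x y z

  p≡m+[2+q]⇒p≢1+m : ∀ {p m} q → p ≡ m + (2 + q) → p ≢ 1 + m
  p≡m+[2+q]⇒p≢1+m {m = m} q p≡m+2+q p≡1+m
    with +-cancelˡ-≡ m (2 + q) 1 (trans (sym p≡m+2+q) (trans p≡1+m (+-comm 1 m)))
  ... | ()

  solution-shift : ∀ w x y → Solution x y (y + x + w) → Solution w x y
  solution-shift w x y sol = +-cancelʳ-≡ (P⁻ x y z) _ _ (begin
    P⁺ w x y + P⁻ x y z      ≡⟨ shift w x y ⟨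
    P⁺ x y z + P⁻ w x y      ≡⟨ cong (_+ P⁻ w x y) sol ⟩
    1 + P⁻ x y z + P⁻ w x y  ≡⟨ cong suc (+-comm (P⁻ x y z) (P⁻ w x y)) ⟩
    1 + P⁻ w x y + P⁻ x y z  ∎)
    where
    open ≡-Reasoning
    z : ℕ
    z = y + x + w
    shift : ∀ w x y → let z = y + x + w in P⁺ x y z + P⁻ w x y ≡ P⁺ w x y + P⁻ x y z
    shift = solve-∀

  gap-below-c≤b : ∀ c d f → let x = 1 + c + d ; y = 1 + x + (c + f) ; z = 1 + y + c in
    P⁺ x y z ≡ P⁻ x y z + (2 +
      (6 * c + 8 * d + 4 * f + 16 * c * d + 8 * c * f + 6 * c * c + 6 * d * f + 12 * d * d
      + 4 * f * f + 6 * c * d * f + 12 * c * d * d + 4 * c * f * f + 8 * c * c * d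
      + 4 * c * c * f + 2 * c * c * c + 2 * d * f * f + 4 * d * d * f + 4 * d * d * d
      + f * f * f))
  gap-below-c≤b = solve-∀

  gap-below-b≤c : ∀ b d f → let x = 1 + (b + f) + d ; y = 1 + x + b ; z = 1 + y + (b + f) in
    P⁺ x y z ≡ P⁻ x y z + (2 +
      (6 * b + 8 * d + 2 * f + 16 * b * d + 4 * b * f + 6 * b * b + 10 * d * f + 12 * d * d
      + 2 * f * f + 10 * b * d * f + 12 * b * d * d + 2 * b * f * f + 8 * b * b * d
      + 2 * b * b * f + 2 * b * b * b + 4 * d * f * f + 8 * d * d * f + 4 * d * d * d
      + f * f * f))
  gap-below-b≤c = solve-∀

  z≤y+x⇒¬Solution : ∀ {x y z} → x < y → y < z → z ≤ y + x → ¬ Solution x y z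
  z≤y+x⇒¬Solution {x} x<y y<z z≤y+x with m≤n⇒∃[o]m+o≡n x<y | m≤n⇒∃[o]m+o≡n y<z
  ... | b , refl | c , refl with m≤n⇒∃[o]m+o≡n (+-cancelˡ-< (suc x + b) c x z≤y+x)
  ...   | d , refl with ≤-total-∃ c b
  ...     | inj₁ (f , refl) = p≡m+[2+q]⇒p≢1+m _ (gap-below-c≤b c d f)
  ...     | inj₂ (f , refl) = p≡m+[2+q]⇒p≢1+m _ (gap-below-b≤c b d f)

  -- Writing x = 1 + a, w = x + e and y = 1 + x + b, the four cones below are y ≤ 2x,
  -- 2x < y ≤ x + w + 1, x + w + 1 < y ≤ 2x + w and 2x + w < y. The first contains the base
  -- solution (1, 1, 2), whence the weaker certificate there.

  excess-above-b≤a : ∀ b e g → let x = 1 + (b + g) ; w = x + e ; y = 1 + x + b in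
    P⁺ w x y ≡ P⁻ w x y + (1 + (b + e + g +
      (2 * b + 4 * e + 3 * g + 10 * b * e + 8 * b * g + 3 * b * b + 14 * e * g + 7 * e * e
      + 8 * g * g + 14 * b * e * g + 7 * b * e * e + 8 * b * g * g + 5 * b * b * e
      + 4 * b * b * g + b * b * b + 8 * e * g * g + 6 * e * e * g + e * e * e + 4 * g * g * g)))
  excess-above-b≤a = solve-∀

  gap-above-g≤e : ∀ a g h → let x = 1 + a ; w = x + (g + h) ; y = 1 + x + (1 + a + g) in
    P⁺ w x y ≡ P⁻ w x y + (2 +
      (2 + 4 * a + 8 * g + 10 * a * g + 6 * a * h + 2 * a * a + 10 * g * h + 8 * g * g
      + 8 * h * h + 10 * a * g * h + 6 * a * g * g + 7 * a * h * h + 4 * a * a * g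
      + 5 * a * a * h + a * a * a + 4 * g * h * h + 4 * g * g * h + 2 * g * g * g + h * h * h))
  gap-above-g≤e = solve-∀

  gap-above-h≤a : ∀ e h k → let x = 1 + (h + k) ; w = x + e ; y = 1 + x + (1 + (h + k) + (e + h)) in
    P⁺ w x y ≡ P⁻ w x y + (2 +
      (2 + 8 * e + 12 * h + 4 * k + 16 * e * h + 10 * e * k + 8 * e * e + 8 * h * k + 12 * h * h
      + 2 * k * k + 10 * e * h * k + 8 * e * h * h + 4 * e * k * k + 8 * e * e * h
      + 6 * e * e * k + 2 * e * e * e + 2 * h * k * k + 4 * h * h * k + 4 * h * h * h
      + k * k * k))
  gap-above-h≤a = solve-∀

  gap-above-a<h : ∀ a e k → let x = 1 + a ; w = x + e ; y = 1 + x + (1 + a + (e + (1 + a + k))) in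
    P⁺ w x y ≡ P⁻ w x y + (2 +
      (17 + 34 * a + 16 * e + 23 * k + 22 * a * e + 28 * a * k + 20 * a * a + 10 * e * k
      + 10 * e * e + 9 * k * k + 6 * a * e * k + 8 * a * e * e + 6 * a * k * k + 8 * a * a * e
      + 8 * a * a * k + 4 * a * a * a + 2 * e * k * k + 2 * e * e * k + 2 * e * e * e
      + k * k * k))
  gap-above-a<h = solve-∀

  y≤2x⇒base : ∀ b e g → let x = 1 + (b + g) ; w = x + e ; y = 1 + x + b in
    Solution w x y → w ≡ 1 × x ≡ 1 × y ≡ 2
  y≤2x⇒base zero    zero    zero    _   = refl , refl , refl
  y≤2x⇒base (suc b) e       g       sol =
    ⊥-elim (p≡m+[2+q]⇒p≢1+m _ (excess-above-b≤a (suc b) e g) sol)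
  y≤2x⇒base zero    (suc e) g       sol =
    ⊥-elim (p≡m+[2+q]⇒p≢1+m _ (excess-above-b≤a 0 (suc e) g) sol)
  y≤2x⇒base zero    zero    (suc g) sol =
    ⊥-elim (p≡m+[2+q]⇒p≢1+m _ (excess-above-b≤a 0 0 (suc g)) sol)

  x≤w⇒base : ∀ {w x y} → 0 < x → x ≤ w → x < y → Solution w x y → w ≡ 1 × x ≡ 1 × y ≡ 2
  x≤w⇒base 0<x x≤w x<y sol with m≤n⇒∃[o]m+o≡n 0<x
  ... | a , refl with m≤n⇒∃[o]m+o≡n x≤w | m≤n⇒∃[o]m+o≡n x<y
  ...   | e , refl | b , refl with ≤-<-connex-∃ b a
  ...     | inj₁ (g , refl) = y≤2x⇒base b e g sol
  ...     | inj₂ (g , refl) with ≤-total-∃ g e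
  ...       | inj₁ (h , refl) = ⊥-elim (p≡m+[2+q]⇒p≢1+m _ (gap-above-g≤e a g h) sol)
  ...       | inj₂ (h , refl) with ≤-<-connex-∃ h a
  ...         | inj₁ (k , refl) = ⊥-elim (p≡m+[2+q]⇒p≢1+m _ (gap-above-h≤a e h k) sol)
  ...         | inj₂ (k , refl) = ⊥-elim (p≡m+[2+q]⇒p≢1+m _ (gap-above-a<h a e k) sol)

  TribonacciTriple : ℤ → ℤ → ℤ → Set
  TribonacciTriple x y z = ∃ λ n → x ≡ T n × y ≡ T (suc n) × z ≡ T (suc (suc n))

  TribonacciTriple-step : ∀ {x y z} → TribonacciTriple x y z → TribonacciTriple y z (z ℤ.+ y ℤ.+ x)
  TribonacciTriple-step (n , refl , refl , refl) = suc n , refl , refl , refl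

  solution⇒TribonacciTriple : ∀ {x y z} → Acc _<_ x → 0 < x → x < y → y < z →
    Solution x y z → TribonacciTriple (+ x) (+ y) (+ z)
  solution⇒TribonacciTriple {x} {y} {z} (acc smaller) 0<x x<y y<z sol with ≤-total z (y + x)
  ... | inj₁ z≤y+x = ⊥-elim (z≤y+x⇒¬Solution x<y y<z z≤y+x sol)
  ... | inj₂ y+x≤z with m≤n⇒∃[o]m+o≡n y+x≤z
  ...   | zero , refl = ⊥-elim (z≤y+x⇒¬Solution x<y y<z (≤-reflexive (+-identityʳ (y + x))) sol)
  ...   | suc w , refl with ≤-<-connex x (suc w)
  ...     | inj₂ w<x = TribonacciTriple-step
    (solution⇒TribonacciTriple (smaller w<x) z<s w<x x<y (solution-shift (suc w) x y sol))
  ...     | inj₁ x≤w with x≤w⇒base 0<x x≤w x<y (solution-shift (suc w) x y sol)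
  ...       | refl , refl , refl = 3 , refl , refl , refl

open import Data.Integer using (_+_; _-_; _*_; _<_; -[1+_]; +<+)
open import Data.Integer.Properties using (pos-*; +-injective)
open import Data.Integer.Tactic.RingSolver using (solve-∀)
import Data.Nat as ℕ
open import Data.Nat.Induction using (<-wellFounded)

P-T≡P⁺-P⁻ : ∀ x y z → P-T (+ x) (+ y) (+ z) ≡ + P⁺ x y z - + P⁻ x y z
P-T≡P⁺-P⁻ x y z = trans (regroup (+ x) (+ y) (+ z)) (sym (cong₂ _-_
  (cong₂ _+_ (cong₂ _+_ (cong₂ _+_ (cong₂ _+_ (cong₂ _+_
    (pos-*³ x x x) (pos-2*³ x x y)) (pos-*³ x x z)) (pos-2*³ x y y)) (pos-2*³ y y y))
    (pos-*³ z z z))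
  (cong₂ _+_ (cong₂ _+_ (pos-2*³ x y z) (pos-*³ x z z)) (pos-2*³ y z z))))
  where
  -- The left-hand side is P-T unfolded: the ring solver does not unfold definitions.
  regroup : ∀ x y z →
    x * x * x + + 2 * x * x * y + x * x * z + + 2 * x * y * y
    - + 2 * x * y * z - x * z * z + + 2 * y * y * y - + 2 * y * z * z
    + z * z * z
    ≡ (x * x * x + + 2 * x * x * y + x * x * z + + 2 * x * y * y + + 2 * y * y * y + z * z * z)
      - (+ 2 * x * y * z + x * z * z + + 2 * y * z * z)
  regroup = solve-∀
  pos-*³ : ∀ a b c → + (a ℕ.* b ℕ.* c) ≡ + a * + b * + c
  pos-*³ a b c = trans (pos-* (a ℕ.* b) c) (cong (_* + c) (pos-* a b))
  pos-2*³ : ∀ a b c → + (2 ℕ.* a ℕ.* b ℕ.* c) ≡ + 2 * + a * + b * + c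
  pos-2*³ a b c = trans (pos-*³ (2 ℕ.* a) b c) (cong (λ t → t * + b * + c) (pos-* 2 a))

P-T≡1⇒Solution : ∀ x y z → P-T (+ x) (+ y) (+ z) ≡ + 1 → Solution x y z
P-T≡1⇒Solution x y z P-T≡1 = +-injective (begin
  + P⁺ x y z                            ≡⟨ a≡a-b+b (+ P⁺ x y z) (+ P⁻ x y z) ⟩
  + P⁺ x y z - + P⁻ x y z + + P⁻ x y z  ≡⟨ cong (_+ + P⁻ x y z) P⁺-P⁻≡1 ⟩
  + 1 + + P⁻ x y z                      ∎)
  where
  open ≡-Reasoning
  a≡a-b+b : ∀ a b → a ≡ a - b + b
  a≡a-b+b = solve-∀
  P⁺-P⁻≡1 : + P⁺ x y z - + P⁻ x y z ≡ + 1
  P⁺-P⁻≡1 = trans (sym (P-T≡P⁺-P⁻ x y z)) P-T≡1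

proposition3p3 : (x y z : ℤ) → + 0 < x → x < y → y < z → P-T x y z ≡ + 1 →
    ∃ λ (n : ℕ) → (x ≡ T n) × (y ≡ T (suc n)) × (z ≡ T (suc (suc n)))
proposition3p3 (+ x) (+ y) (+ z) (+<+ 0<x) (+<+ x<y) (+<+ y<z) P-T≡1 =
  solution⇒TribonacciTriple (<-wellFounded x) 0<x x<y y<z (P-T≡1⇒Solution x y z P-T≡1)
proposition3p3 (+ _) (+ _) -[1+ _ ] _ _ () _
proposition3p3 (+ _) -[1+ _ ] _ _ () _ _
proposition3p3 -[1+ _ ] _ _ () _ _ _
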